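{- Let $d \geq 2$ be an integer, and let $a_1,\ldots,a_d \in \mathbb{Z}$, not all zero, with greatest common divisor $1$. Let \[ \mathcal{L} = \Big\{ (x_1,\ldots,x_d) \in \mathbb{Z}^d \colon \sum_{i=1}^d a_ix_i = 0 \Big\}.\] Let $s = \max_i |a_i|$, and let $m \geq s$ be a positive integer. If $\mathcal{L} \cap [m]^d$ spans a $(d-1)$-dimensional subspace, then $|\mathcal{L} \cap [m]^d| \leq 3^d m^{d-1}/s$.
   Context: For a positive integer $m$, $[m]=\{0,1,\ldots,m-1\}$. -}

module Defs where

open import Data.Nat as ℕ using (ℕ; zero; suc; _⊔_)
open import Data.Nat.GCD using (gcd)
open import Data.Integer as ℤ using (ℤ; 0ℤ; +_; ∣_∣; _≤_; _<_)
open import Data.Fin using (Fin; zero; suc)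
open import Data.Vec as Vec using (Vec; []; _∷_; zipWith; replicate)
open import Data.List as List using (List; upTo; concatMap; filter; length)
open import Data.Product using (Σ; _×_)
open import Relation.Binary.PropositionalEquality using (_≡_)
open import Relation.Nullary using (¬_)

gcdVec : ∀ {d} → Vec ℤ d → ℕ
gcdVec = Vec.foldr _ (λ x g → gcd ∣ x ∣ g) 0

maxAbs : ∀ {d} → Vec ℤ d → ℕ
maxAbs = Vec.foldr _ (λ x g → ∣ x ∣ ⊔ g) 0

NotAllZero : ∀ {d} → Vec ℤ d → Set
NotAllZero {d} a = ¬ (a ≡ replicate d 0ℤ)

dot : ∀ {d} → Vec ℤ d → Vec ℤ d → ℤ
dot a x = Vec.foldr _ ℤ._+_ 0ℤ (zipWith ℤ._*_ a x)

-- x ∈ [m]^d, i.e. 0 ≤ x_i < m for all i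
InBox : ∀ {d} → ℕ → Vec ℤ d → Set
InBox m [] = Data.Unit.⊤ where import Data.Unit
InBox m (x ∷ xs) = (0ℤ ≤ x × x < + m) × InBox m xs

InLBox : ∀ {d} → Vec ℤ d → ℕ → Vec ℤ d → Set
InLBox a m x = (dot a x ≡ 0ℤ) × InBox m x

lincomb : ∀ {k d} → (Fin k → ℤ) → (Fin k → Vec ℤ d) → Vec ℤ d
lincomb {zero}  {d} c v = replicate d 0ℤ
lincomb {suc k} {d} c v =
  zipWith ℤ._+_ (Vec.map (c zero ℤ.*_) (v zero))
                (lincomb (λ i → c (suc i)) (λ i → v (suc i)))

-- linear independence (over ℤ, equivalently over ℚ for integer vectors)
LinIndep : ∀ {k d} → (Fin k → Vec ℤ d) → Set
LinIndep {k} {d} v =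
  (c : Fin k → ℤ) → lincomb c v ≡ replicate d 0ℤ → (i : Fin k) → c i ≡ 0ℤ

SpansDim : ∀ {d} → (Vec ℤ d → Set) → ℕ → Set
SpansDim {d} P k =
  Σ (Fin k → Vec ℤ d) (λ v → ((i : Fin k) → P (v i)) × LinIndep v)
  × ((v : Fin (suc k) → Vec ℤ d) → ((i : Fin (suc k)) → P (v i)) → ¬ LinIndep v)

box : ℕ → (d : ℕ) → List (Vec ℤ d)
box m zero = [] List.∷ List.[]
box m (suc d) = concatMap (λ v → List.map (λ i → (+ i) ∷ v) (upTo m)) (box m d)

countLBox : ∀ {d} → Vec ℤ d → ℕ → ℕ
countLBox a m = length (filter (λ x → dot a x ℤ.≟ 0ℤ) (box m _))

module Submission where

open import Defs
open import Data.Nat as ℕ using (ℕ; zero; suc; NonZero; z≤n; _^_)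
import Data.Nat.Properties as ℕP
open import Data.Nat.GCD using (gcd; gcd-GCD; module Bézout)
open import Data.Integer as ℤ
  using (ℤ; 0ℤ; 1ℤ; -1ℤ; +_; -[1+_]; +[1+_]; ∣_∣; _+_; _*_; -_; _-_; +≤+; +<+)
import Data.Integer.Properties as ℤP
open import Data.Integer.DivMod using (_%ℕ_; _/ℕ_; a≡a%ℕn+[a/ℕn]*n; n%ℕd<d)
open import Data.Integer.Tactic.RingSolver using (solve-∀)
import Data.Nat.Tactic.RingSolver as ℕ-Solver
open import Algebra.Properties.AbelianGroup ℤP.+-0-abelianGroup
  using (∙-cancelˡ; ∙-cancelʳ; x∙y⁻¹≈ε⇒x≈y)
open import Data.Fin using (Fin; zero; suc)
open import Data.Vec as Vec using (Vec; []; _∷_; zipWith; replicate; lookup; _[_]≔_)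
import Data.Vec.Properties as VP
open import Data.List as List
  using (List; []; _∷_; _++_; length; upTo; cartesianProduct; cartesianProductWith; filter)
import Data.List.Properties as LP
open import Data.List.Membership.Propositional using (_∈_)
open import Data.List.Membership.Propositional.Properties
open import Data.List.Relation.Unary.Any using (here; there)
import Data.List.Relation.Unary.All as All
open import Data.List.Relation.Unary.AllPairs using ([]; _∷_)
open import Data.List.Relation.Unary.Unique.Propositional using (Unique)
import Data.List.Relation.Unary.Unique.Propositional.Properties as Unique
open import Data.Product using (∃; ∃₂; _×_; _,_)
open import Data.Sum using (inj₁; inj₂)
open import Data.Empty using (⊥-elim)
open import Relation.Nullary using (yes; no)
open import Relation.Binary.PropositionalEquality
open import Function using (_$_)

-- Let s = ∣aᵢ∣ be a nonzero coefficient and, by Bézout, let a·c = 1. The map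
--   (x , r , t) ↦ x + (r c mod s) + t eᵢ
-- is injective on (ℒ ∩ [m]^d) × [s] × [m]: the value of a· on the image is ≡ r (mod s), which recovers r;
-- it then equals a·(r c mod s) + aᵢ t, which recovers t; and then x. The image lies in [2m + s]^d, so
-- |ℒ ∩ [m]^d| · s · m ≤ (2m + s)^d ≤ (3m)^d once s ≤ m.

infixl 6 _+ᵛ_

_+ᵛ_ : ∀ {d} → Vec ℤ d → Vec ℤ d → Vec ℤ d
_+ᵛ_ = zipWith _+_

+ᵛ-cancelʳ : ∀ {d} (u v w : Vec ℤ d) → u +ᵛ w ≡ v +ᵛ w → u ≡ v
+ᵛ-cancelʳ []      []      []      _  = refl
+ᵛ-cancelʳ (x ∷ u) (y ∷ v) (z ∷ w) eq =
  cong₂ _∷_ (∙-cancelʳ z x y (VP.∷-injectiveˡ eq)) (+ᵛ-cancelʳ u v w (VP.∷-injectiveʳ eq))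

dot-+ᵛ : ∀ {d} (a u v : Vec ℤ d) → dot a (u +ᵛ v) ≡ dot a u + dot a v
dot-+ᵛ []      []      []      = refl
dot-+ᵛ (x ∷ a) (y ∷ u) (z ∷ v) =
  trans (cong (_+_ (x * (y + z))) (dot-+ᵛ a u v)) (interchange x y z _ _)
  where
  interchange : ∀ x y z p q → x * (y + z) + (p + q) ≡ (x * y + p) + (x * z + q)
  interchange = solve-∀

dot-* : ∀ {d} (a c : Vec ℤ d) k → dot a (Vec.map (k *_) c) ≡ k * dot a c
dot-* []      []      k = sym (ℤP.*-zeroʳ k)
dot-* (x ∷ a) (y ∷ c) k = trans (cong (_+_ (x * (k * y))) (dot-* a c k)) (factor x k y _)
  where
  factor : ∀ x k y p → x * (k * y) + k * p ≡ k * (x * y + p)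
  factor = solve-∀

dot-zeroʳ : ∀ {d} (a : Vec ℤ d) → dot a (replicate d 0ℤ) ≡ 0ℤ
dot-zeroʳ []      = refl
dot-zeroʳ (x ∷ a) rewrite dot-zeroʳ a = trans (ℤP.+-identityʳ (x * 0ℤ)) (ℤP.*-zeroʳ x)

dot-[]≔ : ∀ {d} (a : Vec ℤ d) i t → dot a (replicate d 0ℤ [ i ]≔ t) ≡ lookup a i * t
dot-[]≔ (x ∷ a) zero    t = trans (cong (_+_ (x * t)) (dot-zeroʳ a)) (ℤP.+-identityʳ (x * t))
dot-[]≔ (x ∷ a) (suc i) t =
  trans (cong₂ _+_ (ℤP.*-zeroʳ x) (dot-[]≔ a i t)) (ℤP.+-identityˡ (lookup a i * t))

sign-cancels-abs : ∀ x → ∃ λ σ → σ * x ≡ + ∣ x ∣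
sign-cancels-abs (+ n)    = 1ℤ , ℤP.*-identityˡ (+ n)
sign-cancels-abs -[1+ n ] = -1ℤ , ℤP.-1*i≡-i -[1+ n ]

sign-times-abs : ∀ x → ∃ λ σ → σ * + ∣ x ∣ ≡ x
sign-times-abs (+ n)    = 1ℤ , ℤP.*-identityˡ (+ n)
sign-times-abs -[1+ n ] = -1ℤ , ℤP.-1*i≡-i +[1+ n ]

pos-linear : ∀ g y q x p → g ℕ.+ y ℕ.* q ≡ x ℕ.* p → + g + + y * + q ≡ + x * + p
pos-linear g y q x p eq = begin
  + g + + y * + q     ≡⟨ cong (_+_ (+ g)) (ℤP.pos-* y q) ⟨
  + g + + (y ℕ.* q)   ≡⟨ ℤP.pos-+ g (y ℕ.* q) ⟨
  + (g ℕ.+ y ℕ.* q)   ≡⟨ cong +_ eq ⟩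
  + (x ℕ.* p)         ≡⟨ ℤP.pos-* x p ⟩
  + x * + p           ∎
  where open ≡-Reasoning

gcd-ℤ-combination : ∀ p q → ∃₂ λ u v → + gcd p q ≡ u * + p + v * + q
gcd-ℤ-combination p q with Bézout.identity (gcd-GCD p q)
... | Bézout.+- x y eq = + x , - + y ,
  ∙-cancelʳ (+ y * + q) _ _ (trans (pos-linear _ y q x p eq) (move (+ x * + p) (+ y) (+ q)))
  where
  move : ∀ a y q → a ≡ (a + (- y) * q) + y * q
  move = solve-∀
... | Bézout.-+ x y eq = - + x , + y ,
  ∙-cancelʳ (+ x * + p) _ _ (trans (pos-linear _ x p y q eq) (move (+ x) (+ p) (+ y * + q)))
  where
  move : ∀ x p b → b ≡ ((- x) * p + b) + x * p
  move = solve-∀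

dot-gcdVec : ∀ {d} (a : Vec ℤ d) → ∃ λ c → dot a c ≡ + gcdVec a
dot-gcdVec []      = [] , refl
dot-gcdVec (x ∷ a) with dot-gcdVec a | sign-cancels-abs x | gcd-ℤ-combination ∣ x ∣ (gcdVec a)
... | c , a·c≡g | σ , σx≡∣x∣ | u , v , g≡ = u * σ ∷ Vec.map (v *_) c , (begin
  x * (u * σ) + dot a (Vec.map (v *_) c)  ≡⟨ cong (_+_ (x * (u * σ))) (dot-* a c v) ⟩
  x * (u * σ) + v * dot a c               ≡⟨ cong (λ g → x * (u * σ) + v * g) a·c≡g ⟩
  x * (u * σ) + v * + gcdVec a            ≡⟨ reassociate x u σ (v * + gcdVec a) ⟩
  u * (σ * x) + v * + gcdVec a            ≡⟨ cong (λ k → u * k + v * + gcdVec a) σx≡∣x∣ ⟩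
  u * + ∣ x ∣ + v * + gcdVec a            ≡⟨ g≡ ⟨
  + gcdVec (x ∷ a)                        ∎)
  where
  open ≡-Reasoning
  reassociate : ∀ x u σ w → x * (u * σ) + w ≡ u * (σ * x) + w
  reassociate = solve-∀

module _ (s : ℕ) .{{_ : NonZero s}} where

  a%ℕn≡a-[a/ℕn]*n : ∀ n → + (n %ℕ s) ≡ n - (n /ℕ s) * + s
  a%ℕn≡a-[a/ℕn]*n n = ∙-cancelʳ ((n /ℕ s) * + s) _ _ $
    trans (sym (a≡a%ℕn+[a/ℕn]*n n s)) (add-back n ((n /ℕ s) * + s))
    where
    add-back : ∀ n p → n ≡ (n - p) + p
    add-back = solve-∀

  scaleMod : ∀ {d} → ℕ → Vec ℤ d → Vec ℤ d
  scaleMod r = Vec.map (λ cⱼ → + ((+ r * cⱼ) %ℕ s))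

  dot-scaleMod : ∀ {d} (a c : Vec ℤ d) r →
    ∃ λ k → dot a (scaleMod r c) ≡ + r * dot a c + k * + s
  dot-scaleMod []      []       r = 0ℤ , sym (trans (ℤP.+-identityʳ (+ r * 0ℤ)) (ℤP.*-zeroʳ (+ r)))
  dot-scaleMod (x ∷ a) (cⱼ ∷ c) r with dot-scaleMod a c r
  ... | k , eq = k - x * q , (begin
    x * + ((+ r * cⱼ) %ℕ s) + dot a (scaleMod r c)
      ≡⟨ cong₂ (λ u w → x * u + w) (a%ℕn≡a-[a/ℕn]*n (+ r * cⱼ)) eq ⟩
    x * (+ r * cⱼ - q * + s) + (+ r * dot a c + k * + s)
      ≡⟨ collect x (+ r) cⱼ q (+ s) (dot a c) k ⟩
    + r * (x * cⱼ + dot a c) + (k - x * q) * + s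
      ∎)
    where
    open ≡-Reasoning
    q : ℤ
    q = (+ r * cⱼ) /ℕ s
    collect : ∀ x r c q s D k →
      x * (r * c - q * s) + (r * D + k * s) ≡ r * (x * c + D) + (k - x * q) * s
    collect = solve-∀

  scaleMod-bounded : ∀ {d} r (c : Vec ℤ d) → InBox s (scaleMod r c)
  scaleMod-bounded r []       = _
  scaleMod-bounded r (cⱼ ∷ c) = (+≤+ z≤n , +<+ (n%ℕd<d (+ r * cⱼ) s)) , scaleMod-bounded r c

multiple-of-successor-≥ : ∀ {s r r'} n → + r - + r' ≡ +[1+ n ] * + s → s ℕ.≤ r
multiple-of-successor-≥ {s} {r} {r'} n eq = begin
  s                        ≤⟨ ℕP.m≤m+n s (n ℕ.* s) ⟩
  suc n ℕ.* s              ≤⟨ ℕP.m≤n+m _ r' ⟩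
  r' ℕ.+ suc n ℕ.* s       ≡⟨ ℤP.+-injective r'+[r-r']≡r ⟩
  r                        ∎
  where
  open ℕP.≤-Reasoning
  r'+[r-r']≡r : + (r' ℕ.+ suc n ℕ.* s) ≡ + r
  r'+[r-r']≡r = trans (ℤP.pos-+ r' _)
    (trans (cong (_+_ (+ r')) (trans (ℤP.pos-* (suc n) s) (sym eq))) (cancel (+ r') (+ r)))
    where
    cancel : ∀ a b → a + (b - a) ≡ b
    cancel = solve-∀

remainder-unique : ∀ {s r r'} (k k' : ℤ) → r ℕ.< s → r' ℕ.< s →
  + r + k * + s ≡ + r' + k' * + s → r ≡ r'
remainder-unique {s} {r} {r'} k k' r<s r'<s eq = from-difference (k' - k) difference
  where
  difference : + r - + r' ≡ (k' - k) * + s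
  difference = begin
    + r - + r'                            ≡⟨ add-to-both (+ r) (+ r') (k * + s) ⟩
    (+ r + k * + s) - (+ r' + k * + s)    ≡⟨ cong (_- (+ r' + k * + s)) eq ⟩
    (+ r' + k' * + s) - (+ r' + k * + s)  ≡⟨ collect (+ r') k k' (+ s) ⟩
    (k' - k) * + s                        ∎
    where
    open ≡-Reasoning
    add-to-both : ∀ a b c → a - b ≡ (a + c) - (b + c)
    add-to-both = solve-∀
    collect : ∀ r' k k' s → (r' + k' * s) - (r' + k * s) ≡ (k' - k) * s
    collect = solve-∀
  from-difference : ∀ δ → + r - + r' ≡ δ * + s → r ≡ r'
  from-difference (+ zero)  eq = ℤP.+-injective (x∙y⁻¹≈ε⇒x≈y (+ r) (+ r') eq)
  from-difference +[1+ n ]  eq = ⊥-elim (ℕP.<⇒≱ r<s (multiple-of-successor-≥ {r' = r'} n eq))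
  from-difference -[1+ n ]  eq = ⊥-elim (ℕP.<⇒≱ r'<s (multiple-of-successor-≥ {r' = r} n (begin
    + r' - + r          ≡⟨ swap (+ r) (+ r') ⟩
    - (+ r - + r')      ≡⟨ cong -_ eq ⟩
    - (-[1+ n ] * + s)  ≡⟨ ℤP.neg-distribˡ-* -[1+ n ] (+ s) ⟩
    +[1+ n ] * + s      ∎)))
    where
    open ≡-Reasoning
    swap : ∀ a b → b - a ≡ - (a - b)
    swap = solve-∀

maxAbs-attained : ∀ {d} (a : Vec ℤ (suc d)) → ∃ λ i → ∣ lookup a i ∣ ≡ maxAbs a
maxAbs-attained (x ∷ [])    = zero , sym (ℕP.⊔-identityʳ ∣ x ∣)
maxAbs-attained (x ∷ y ∷ a) with maxAbs-attained (y ∷ a) | ∣ x ∣ ℕ.≤? maxAbs (y ∷ a)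
... | i , eq | yes ∣x∣≤ = suc i , trans eq (sym (ℕP.m≤n⇒m⊔n≡n ∣x∣≤))
... | _      | no  ∣x∣≰ = zero , sym (ℕP.m≥n⇒m⊔n≡m (ℕP.≰⇒≥ ∣x∣≰))

InBox-+ᵛ : ∀ {p q d} (x y : Vec ℤ d) → InBox p x → InBox q y → InBox (p ℕ.+ q) (x +ᵛ y)
InBox-+ᵛ []      []      _ _ = _
InBox-+ᵛ (x ∷ u) (y ∷ v) ((0≤x , x<p) , u∈) ((0≤y , y<q) , v∈) =
  (ℤP.+-mono-≤ 0≤x 0≤y , ℤP.+-mono-< x<p y<q) , InBox-+ᵛ u v u∈ v∈

InBox-zero : ∀ {m} d → 0 ℕ.< m → InBox m (replicate d 0ℤ)
InBox-zero zero    _   = _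
InBox-zero (suc d) 0<m = (+≤+ z≤n , +<+ 0<m) , InBox-zero d 0<m

InBox-[]≔ : ∀ {m d} (i : Fin d) t → t ℕ.< m → InBox m (replicate d 0ℤ [ i ]≔ + t)
InBox-[]≔ {d = suc d} zero    t t<m = (+≤+ z≤n , +<+ t<m) , InBox-zero d (ℕP.≤-<-trans z≤n t<m)
InBox-[]≔ {d = suc d} (suc i) t t<m = (+≤+ z≤n , +<+ (ℕP.≤-<-trans z≤n t<m)) , InBox-[]≔ i t t<m

box-suc : ∀ m d → box m (suc d) ≡ cartesianProductWith (λ v i → + i ∷ v) (box m d) (upTo m)
box-suc m d = go (box m d)
  where
  go : ∀ (vs : List (Vec ℤ d)) → List.concatMap (λ v → List.map (λ i → + i ∷ v) (upTo m)) vs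
                                 ≡ cartesianProductWith (λ v i → + i ∷ v) vs (upTo m)
  go []       = refl
  go (v ∷ vs) = cong (List.map (λ i → + i ∷ v) (upTo m) ++_) (go vs)

length-cartesianProductWith : ∀ {A B C : Set} (f : A → B → C) xs ys →
  length (cartesianProductWith f xs ys) ≡ length xs ℕ.* length ys
length-cartesianProductWith f []       ys = refl
length-cartesianProductWith f (x ∷ xs) ys = trans (LP.length-++ (List.map (f x) ys))
  (cong₂ ℕ._+_ (LP.length-map (f x) ys) (length-cartesianProductWith f xs ys))

length-box : ∀ m d → length (box m d) ≡ m ^ d
length-box m zero    = refl
length-box m (suc d) = begin
  length (box m (suc d))                ≡⟨ cong length (box-suc m d) ⟩
  length (cartesianProductWith (λ v i → + i ∷ v) (box m d) (upTo m))
                                        ≡⟨ length-cartesianProductWith _ (box m d) (upTo m) ⟩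
  length (box m d) ℕ.* length (upTo m)  ≡⟨ cong₂ ℕ._*_ (length-box m d) (LP.length-upTo m) ⟩
  m ^ d ℕ.* m                           ≡⟨ ℕP.*-comm (m ^ d) m ⟩
  m ℕ.* m ^ d                           ∎
  where open ≡-Reasoning

∈-box⁺ : ∀ {m d} (v : Vec ℤ d) → InBox m v → v ∈ box m d
∈-box⁺             []        _                   = here refl
∈-box⁺ {m} {suc d} (+ k ∷ v) ((_ , +<+ k<m) , v∈) =
  subst (+ k ∷ v ∈_) (sym (box-suc m d)) (∈-cartesianProductWith⁺ _ (∈-box⁺ v v∈) (∈-upTo⁺ k<m))

∈-box⁻ : ∀ {m d} (v : Vec ℤ d) → v ∈ box m d → InBox m v
∈-box⁻ {m} {zero}  [] _ = _
∈-box⁻ {m} {suc d} v v∈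
  with ∈-cartesianProductWith⁻ _ (box m d) (upTo m) (subst (v ∈_) (box-suc m d) v∈)
... | w , k , w∈ , k∈ , refl = (+≤+ z≤n , +<+ (∈-upTo⁻ k∈)) , ∈-box⁻ w w∈

box-unique : ∀ m d → Unique (box m d)
box-unique m zero    = All.[] ∷ []
box-unique m (suc d) = subst Unique (sym (box-suc m d))
  (Unique.cartesianProductWith⁺ _ ∷-injective (box-unique m d) (Unique.upTo⁺ m))
  where
  ∷-injective : ∀ {v w : Vec ℤ d} {i j} → + i ∷ v ≡ + j ∷ w → v ≡ w × i ≡ j
  ∷-injective refl = refl , refl

length-≤-by-injection : ∀ {A B : Set} (f : A → B) (xs : List A) (ys : List B) → Unique xs →
  (∀ {x} → x ∈ xs → f x ∈ ys) → (∀ {x y} → x ∈ xs → y ∈ xs → f x ≡ f y → x ≡ y) →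
  length xs ℕ.≤ length ys
length-≤-by-injection f []       ys _          _     _   = z≤n
length-≤-by-injection f (x ∷ xs) ys (x∉ ∷ xs!) maps! inj with ∈-∃++ (maps! (here refl))
... | us , vs , refl = begin
  suc (length xs)                 ≤⟨ ℕ.s≤s (length-≤-by-injection f xs (us ++ vs) xs! maps-into-rest
                                                                 (λ p q → inj (there p) (there q))) ⟩
  suc (length (us ++ vs))         ≡⟨ cong suc (LP.length-++ us) ⟩
  suc (length us ℕ.+ length vs)   ≡⟨ ℕP.+-suc (length us) (length vs) ⟨
  length us ℕ.+ length (f x ∷ vs) ≡⟨ LP.length-++ us ⟨
  length (us ++ f x ∷ vs)         ∎
  where
  open ℕP.≤-Reasoning
  maps-into-rest : ∀ {y} → y ∈ xs → f y ∈ us ++ vs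
  maps-into-rest {y} y∈ with ∈-++⁻ us (maps! (there y∈))
  ... | inj₁ fy∈us         = ∈-++⁺ˡ fy∈us
  ... | inj₂ (here fy≡fx)  = ⊥-elim (All.lookup x∉ y∈ (sym (inj (there y∈) (here refl) fy≡fx)))
  ... | inj₂ (there fy∈vs) = ∈-++⁺ʳ us fy∈vs

module _ {d} (a c : Vec ℤ d) (a·c≡1 : dot a c ≡ 1ℤ)
         (i : Fin d) .{{_ : ℤ.NonZero (lookup a i)}} (m : ℕ) where

  private
    s : ℕ
    s = ∣ lookup a i ∣

  solutions : List (Vec ℤ d)
  solutions = filter (λ x → dot a x ℤ.≟ 0ℤ) (box m d)

  triples : List (Vec ℤ d × ℕ × ℕ)
  triples = cartesianProduct solutions (cartesianProduct (upTo s) (upTo m))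

  shift : Vec ℤ d × ℕ × ℕ → Vec ℤ d
  shift (x , r , t) = x +ᵛ scaleMod s r c +ᵛ (replicate d 0ℤ [ i ]≔ + t)

  ∈-triples⁻ : ∀ {x r t} → (x , r , t) ∈ triples →
    (InBox m x × dot a x ≡ 0ℤ) × r ℕ.< s × t ℕ.< m
  ∈-triples⁻ xrt∈ with ∈-cartesianProduct⁻ solutions _ xrt∈
  ... | x∈ , rt∈
    with ∈-filter⁻ (λ x → dot a x ℤ.≟ 0ℤ) {xs = box m d} x∈ | ∈-cartesianProduct⁻ (upTo s) (upTo m) rt∈
  ... | x∈box , ax≡0 | r∈ , t∈ = (∈-box⁻ _ x∈box , ax≡0) , ∈-upTo⁻ r∈ , ∈-upTo⁻ t∈

  dot-shift : ∀ x r t →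
    dot a (shift (x , r , t)) ≡ dot a x + dot a (scaleMod s r c) + lookup a i * + t
  dot-shift x r t =
    trans (dot-+ᵛ a (x +ᵛ scaleMod s r c) _) (cong₂ _+_ (dot-+ᵛ a x _) (dot-[]≔ a i (+ t)))

  shift-residue : ∀ x r t → dot a x ≡ 0ℤ → ∃ λ k → dot a (shift (x , r , t)) ≡ + r + k * + s
  shift-residue x r t ax≡0 with dot-scaleMod s a c r | sign-times-abs (lookup a i)
  ... | k , a·z≡ | σ , σs≡aᵢ = k + σ * + t , (begin
    dot a (shift (x , r , t))
      ≡⟨ dot-shift x r t ⟩
    dot a x + dot a (scaleMod s r c) + lookup a i * + t
      ≡⟨ cong₂ (λ u w → u + w + lookup a i * + t) ax≡0 a·z≡ ⟩
    0ℤ + (+ r * dot a c + k * + s) + lookup a i * + t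
      ≡⟨ cong₂ (λ u w → 0ℤ + (+ r * u + k * + s) + w * + t) a·c≡1 (sym σs≡aᵢ) ⟩
    0ℤ + (+ r * 1ℤ + k * + s) + σ * + s * + t
      ≡⟨ collect (+ r) k (+ s) σ (+ t) ⟩
    + r + (k + σ * + t) * + s
      ∎)
    where
    open ≡-Reasoning
    collect : ∀ r k s σ t → 0ℤ + (r * 1ℤ + k * s) + σ * s * t ≡ r + (k + σ * t) * s
    collect = solve-∀

  shift-determines-t : ∀ {x x' r t t'} → dot a x ≡ dot a x' →
    shift (x , r , t) ≡ shift (x' , r , t') → t ≡ t'
  shift-determines-t {x} {x'} {r} {t} {t'} ax≡ax' eq =
    ℤP.+-injective $ ℤP.*-cancelˡ-≡ (lookup a i) (+ t) (+ t') $
    ∙-cancelˡ (dot a x' + z) _ _ $ begin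
      dot a x' + z + lookup a i * + t  ≡⟨ cong (λ u → u + z + lookup a i * + t) ax≡ax' ⟨
      dot a x + z + lookup a i * + t   ≡⟨ dot-shift x r t ⟨
      dot a (shift (x , r , t))        ≡⟨ cong (dot a) eq ⟩
      dot a (shift (x' , r , t'))      ≡⟨ dot-shift x' r t' ⟩
      dot a x' + z + lookup a i * + t' ∎
    where
    open ≡-Reasoning
    z : ℤ
    z = dot a (scaleMod s r c)

  shift-injective : ∀ {y y'} → y ∈ triples → y' ∈ triples → shift y ≡ shift y' → y ≡ y'
  shift-injective {x , r , t} {x' , r' , t'} y∈ y'∈ eq
    with ∈-triples⁻ y∈ | ∈-triples⁻ y'∈
  ... | (_ , ax≡0) , r<s , _ | (_ , ax'≡0) , r'<s , _
    with shift-residue x r t ax≡0 | shift-residue x' r' t' ax'≡0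
  ... | k , a·y≡ | k' , a·y'≡
    with remainder-unique k k' r<s r'<s (trans (sym a·y≡) (trans (cong (dot a) eq) a·y'≡))
  ... | refl with shift-determines-t {x} {x'} {r} (trans ax≡0 (sym ax'≡0)) eq
  ... | refl = cong (_, r , t) (+ᵛ-cancelʳ x x' (scaleMod s r c) (+ᵛ-cancelʳ _ _ _ eq))

  shift-bounded : ∀ {y} → y ∈ triples → shift y ∈ box (m ℕ.+ s ℕ.+ m) d
  shift-bounded {x , r , t} y∈ with ∈-triples⁻ y∈
  ... | (x∈ , _) , _ , t<m = ∈-box⁺ (shift (x , r , t))
    (InBox-+ᵛ (x +ᵛ scaleMod s r c) _
      (InBox-+ᵛ x (scaleMod s r c) x∈ (scaleMod-bounded s r c)) (InBox-[]≔ i t t<m))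

  countLBox-bound : countLBox a m ℕ.* s ℕ.* m ℕ.≤ (m ℕ.+ s ℕ.+ m) ^ d
  countLBox-bound = begin
    countLBox a m ℕ.* s ℕ.* m          ≡⟨ ℕP.*-assoc (length solutions) s m ⟩
    length solutions ℕ.* (s ℕ.* m)     ≡⟨ length-triples ⟨
    length triples                     ≤⟨ length-≤-by-injection shift triples _
                                            triples-unique shift-bounded shift-injective ⟩
    length (box (m ℕ.+ s ℕ.+ m) d)     ≡⟨ length-box _ d ⟩
    (m ℕ.+ s ℕ.+ m) ^ d                ∎
    where
    open ℕP.≤-Reasoning
    length-triples : length triples ≡ length solutions ℕ.* (s ℕ.* m)
    length-triples = trans (length-cartesianProductWith _,_ solutions _) $ cong (length solutions ℕ.*_) $
      trans (length-cartesianProductWith _,_ (upTo s) (upTo m)) (cong₂ ℕ._*_ (LP.length-upTo s) (LP.length-upTo m))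
    triples-unique : Unique triples
    triples-unique = Unique.cartesianProduct⁺ (Unique.filter⁺ _ (box-unique m d))
      (Unique.cartesianProduct⁺ (Unique.upTo⁺ s) (Unique.upTo⁺ m))

^-distrib-* : ∀ m n k → (m ℕ.* n) ^ k ≡ m ^ k ℕ.* n ^ k
^-distrib-* m n zero    = refl
^-distrib-* m n (suc k) =
  trans (cong (m ℕ.* n ℕ.*_) (^-distrib-* m n k)) (interchange m n (m ^ k) (n ^ k))
  where
  interchange : ∀ m n x y → m ℕ.* n ℕ.* (x ℕ.* y) ≡ m ℕ.* x ℕ.* (n ℕ.* y)
  interchange = ℕ-Solver.solve-∀

wide-box-volume : ∀ d {s m} → s ℕ.≤ m → (m ℕ.+ s ℕ.+ m) ^ suc d ℕ.≤ 3 ^ suc d ℕ.* m ^ d ℕ.* m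
wide-box-volume d {s} {m} s≤m = begin
  (m ℕ.+ s ℕ.+ m) ^ suc d      ≤⟨ ℕP.^-monoˡ-≤ (suc d) (ℕP.+-monoˡ-≤ m (ℕP.+-monoʳ-≤ m s≤m)) ⟩
  (m ℕ.+ m ℕ.+ m) ^ suc d      ≡⟨ cong (_^ suc d) (triple m) ⟩
  (3 ℕ.* m) ^ suc d            ≡⟨ ^-distrib-* 3 m (suc d) ⟩
  3 ^ suc d ℕ.* (m ℕ.* m ^ d)  ≡⟨ cong (3 ^ suc d ℕ.*_) (ℕP.*-comm m (m ^ d)) ⟩
  3 ^ suc d ℕ.* (m ^ d ℕ.* m)  ≡⟨ ℕP.*-assoc (3 ^ suc d) (m ^ d) m ⟨
  3 ^ suc d ℕ.* m ^ d ℕ.* m    ∎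
  where
  open ℕP.≤-Reasoning
  triple : ∀ m → m ℕ.+ m ℕ.+ m ≡ 3 ℕ.* m
  triple = ℕ-Solver.solve-∀

lemma2p2 : (d : ℕ) → 2 ℕ.≤ d → (a : Vec ℤ d) → NotAllZero a → gcdVec a ≡ 1
    → (m : ℕ) → 1 ℕ.≤ m → maxAbs a ℕ.≤ m
    → SpansDim (InLBox a m) (d ℕ.∸ 1)
    → countLBox a m ℕ.* maxAbs a ℕ.≤ 3 ^ d ℕ.* m ^ (d ℕ.∸ 1)
lemma2p2 (suc d) _ a _ gcd≡1 m@(suc _) _ s≤m _
  with i , ∣aᵢ∣≡s ← maxAbs-attained a
  with c , a·c≡g ← dot-gcdVec a
  with ∣ lookup a i ∣ ℕ.≟ 0
... | yes ∣aᵢ∣≡0 = ℕP.≤-trans (ℕP.≤-reflexive count*s≡0) z≤n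
  where
  count*s≡0 : countLBox a m ℕ.* maxAbs a ≡ 0
  count*s≡0 =
    trans (cong (countLBox a m ℕ.*_) (trans (sym ∣aᵢ∣≡s) ∣aᵢ∣≡0)) (ℕP.*-zeroʳ (countLBox a m))
... | no ∣aᵢ∣≢0 = subst (λ s → countLBox a m ℕ.* s ℕ.≤ 3 ^ suc d ℕ.* m ^ d) ∣aᵢ∣≡s
  (ℕP.*-cancelʳ-≤ _ _ m (ℕP.≤-trans counted (wide-box-volume d ∣aᵢ∣≤m)))
  where
  instance
    aᵢ≢0 : ℤ.NonZero (lookup a i)
    aᵢ≢0 = ℕ.≢-nonZero ∣aᵢ∣≢0
  counted : countLBox a m ℕ.* ∣ lookup a i ∣ ℕ.* m ℕ.≤ (m ℕ.+ ∣ lookup a i ∣ ℕ.+ m) ^ suc d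
  counted = countLBox-bound a c (trans a·c≡g (cong +_ gcd≡1)) i m
  ∣aᵢ∣≤m : ∣ lookup a i ∣ ℕ.≤ m
  ∣aᵢ∣≤m = subst (ℕ._≤ m) (sym ∣aᵢ∣≡s) s≤m
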